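{- Let $A$ be an ordered alphabet and $A^{\ast}$ the free monoid ordered by the Higman ordering. The set $F^{\circ}(A^{\ast}):=F(A^{\ast})\setminus\{\emptyset\}$ of non-empty final segments is a graded and cancellative submonoid of $F(A^{\ast})$.
   Context: Higman ordering: $a_0\cdots a_{n-1}\le b_0\cdots b_{m-1}$ iff there is a strictly increasing $h$ with $a_i\le b_{h(i)}$ for all $i$. $F(A^{\ast})$ is the monoid of final segments (upward closed subsets) of $A^{\ast}$ under concatenation $XY=\{\alpha\beta:\alpha\in X,\beta\in Y\}$, with neutral element $A^{\ast}$. A monoid $V$ with neutral element $\mathbf 1$ is graded if there is a monoid morphism $\gamma$ from $V$ into the additive monoid of non-negative integers with $\gamma^{ -1}(0)=\{\mathbf 1\}$. Cancellative: $XY=XZ\Rightarrow Y=Z$ and $YX=ZX\Rightarrow Y=Z$. -}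

module Defs where

open import Level using (Level; _⊔_; Lift)
open import Data.Unit.Polymorphic using (⊤)
open import Data.List using (List; []; _∷_; _++_)
open import Data.Nat using (ℕ; _+_)
open import Data.Product using (Σ; _×_; _,_; ∃; ∃-syntax)
open import Relation.Binary.Bundles using (Poset)
open import Relation.Binary.PropositionalEquality using (_≡_)

module Higman {c ℓ₁ ℓ₂ : Level} (P : Poset c ℓ₁ ℓ₂) where
  open Poset P renaming (Carrier to A)

  Word : Set c
  Word = List A

  -- Higman ordering: u ≤ᴴ v iff there is a strictly increasing h with
  -- u_i ≤ v_(h i) for all i  (standard inductive presentation).
  data _≤ᴴ_ : Word → Word → Set (c ⊔ ℓ₂) where
    []≤   : ∀ {v} → [] ≤ᴴ v
    keep  : ∀ {a b u v} → a ≤ b → u ≤ᴴ v → (a ∷ u) ≤ᴴ (b ∷ v)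
    skip  : ∀ {u b v} → u ≤ᴴ v → u ≤ᴴ (b ∷ v)

  L : Level
  L = c ⊔ ℓ₁ ⊔ ℓ₂

  Subset : Set (Level.suc L)
  Subset = Word → Set L

  IsFinal : Subset → Set L
  IsFinal X = ∀ {u v} → X u → u ≤ᴴ v → X v

  NonEmpty : Subset → Set L
  NonEmpty X = ∃[ u ] X u

  InF° : Subset → Set L
  InF° X = IsFinal X × NonEmpty X

  _≐_ : Subset → Subset → Set L
  X ≐ Y = (∀ u → X u → Y u) × (∀ u → Y u → X u)

  _·_ : Subset → Subset → Subset
  (X · Y) w = ∃[ α ] ∃[ β ] (X α × Y β × w ≡ α ++ β)

  A* : Subset
  A* _ = ⊤

  -- F°(A*) is graded: a monoid morphism γ : F° → (ℕ,+,0) with γ⁻¹(0) = {A*}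
  -- (γ is a function on subsets, required to be well defined on F° w.r.t. ≐).
  IsGrading : (Subset → ℕ) → Set (Level.suc L)
  IsGrading γ =
      (∀ X Y → InF° X → InF° Y → X ≐ Y → γ X ≡ γ Y)
    × (∀ X Y → InF° X → InF° Y → γ (X · Y) ≡ γ X + γ Y)
    × (γ A* ≡ 0)
    × (∀ X → InF° X → γ X ≡ 0 → X ≐ A*)

  Graded : Set (Level.suc L)
  Graded = Σ (Subset → ℕ) IsGrading

  Cancellative : Set (Level.suc L)
  Cancellative =
      (∀ X Y Z → InF° X → InF° Y → InF° Z → (X · Y) ≐ (X · Z) → Y ≐ Z)
    × (∀ X Y Z → InF° X → InF° Y → InF° Z → (Y · X) ≐ (Z · X) → Y ≐ Z)

  Submonoid : Set (Level.suc L)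
  Submonoid = InF° A* × (∀ X Y → InF° X → InF° Y → InF° (X · Y))

module Submission where

-- * Submonoid: A* is a non-empty final segment, and X·Y is final because
--   any Higman-extension of a product αβ splits as α'β' with α ≤ᴴ α' and
--   β ≤ᴴ β' ("splitting lemma").
-- * Grading: the degree of X is the length of a shortest word of X.  Such a
--   word exists by the least number principle, which needs excluded middle
--   since membership in X is not decidable.  Shortest words of X and Y
--   concatenate to a shortest word of X·Y, so the degree is additive; a
--   final segment of degree 0 contains the empty word, hence is all of A*.
-- * Cancellation: if α is a shortest word of X and β ∈ Y, then αβ ∈ X·Z gives
--   αβ = α'γ with α' ∈ X, γ ∈ Z and |α| ≤ |α'|, so γ is a suffix of β and
--   β ∈ Z by finality (symmetrically on the right).  The word combinatorics
--   is the equidivisibility of the free monoid.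

open import Defs
open import Level using (Level; _⊔_)
open import Data.Product using (_×_; _,_; ∃; ∃-syntax)
open import Data.List using (List; []; _∷_; _++_; length)
open import Data.List.Properties using (length-++; ∷-injective)
open import Data.Nat using (ℕ; _+_; _≤_; _<_; z≤n; s≤s)
open import Data.Nat.Properties
  using (≤-antisym; ≮⇒≥; +-mono-≤; +-monoʳ-≤; +-cancelʳ-≤; ≤-reflexive; ≤-trans)
open import Data.Nat.Induction using (<-rec)
open import Data.Unit.Polymorphic using (tt)
open import Data.Empty using (⊥-elim)
open import Relation.Nullary using (yes; no)
open import Relation.Binary.Bundles using (Poset)
open import Relation.Binary.PropositionalEquality
  using (_≡_; refl; sym; trans; cong; cong₂; subst; subst₂; module ≡-Reasoning)
open import Axiom.ExcludedMiddle using (ExcludedMiddle)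

++-equidivisible : ∀ {a} {S : Set a} (α β α' β' : List S) → length α ≤ length α'
                 → α ++ β ≡ α' ++ β' → ∃[ δ ] (α' ≡ α ++ δ × β ≡ δ ++ β')
++-equidivisible []      β α'       β' _         eq = α' , refl , eq
++-equidivisible (a ∷ α) β (b ∷ α') β' (s≤s |α|≤|α'|) eq
  with refl , αβ≡α'β' ← ∷-injective eq
  with δ , refl , β≡δβ' ← ++-equidivisible α β α' β' |α|≤|α'| αβ≡α'β'
  = δ , refl , β≡δβ'

++-prefix-of-shorter-tail : ∀ {a} {S : Set a} (β α γ α' : List S) → length α ≤ length α'
                          → β ++ α ≡ γ ++ α' → ∃[ δ ] (β ≡ γ ++ δ)
++-prefix-of-shorter-tail β α γ α' |α|≤|α'| eq =
  let δ , β≡γδ , _ = ++-equidivisible γ α' β α |γ|≤|β| (sym eq) in δ , β≡γδ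
  where
  -- |γ| + |α| ≤ |γ| + |α'| = |β| + |α|
  |γ|≤|β| : length γ ≤ length β
  |γ|≤|β| = +-cancelʳ-≤ (length α) (length γ) (length β)
    (≤-trans (+-monoʳ-≤ (length γ) |α|≤|α'|)
      (≤-reflexive (trans (sym (length-++ γ)) (trans (cong length (sym eq)) (length-++ β)))))

module LeastNumber {ℓ : Level} (lem : ExcludedMiddle ℓ) (Q : ℕ → Set ℓ) where

  IsLeast : ℕ → Set ℓ
  IsLeast m = Q m × (∀ k → Q k → m ≤ k)

  least : ∀ n → Q n → ∃ IsLeast
  least = <-rec (λ n → Q n → ∃ IsLeast) step
    where
    step : ∀ n → (∀ {k} → k < n → Q k → ∃ IsLeast) → Q n → ∃ IsLeast
    step n below qn with lem {∃[ k ] (Q k × k < n)}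
    ... | yes (k , qk , k<n) = below k<n qk
    ... | no noSmaller = n , qn , λ k qk → ≮⇒≥ (λ k<n → noSmaller (k , qk , k<n))

module HigmanFacts {c ℓ₁ ℓ₂ : Level} (P : Poset c ℓ₁ ℓ₂) where
  open Poset P using () renaming (refl to ≤-refl)
  open Higman P

  ≤ᴴ-refl : ∀ u → u ≤ᴴ u
  ≤ᴴ-refl []      = []≤
  ≤ᴴ-refl (a ∷ u) = keep ≤-refl (≤ᴴ-refl u)

  ≤ᴴ-suffix : ∀ δ u → u ≤ᴴ (δ ++ u)
  ≤ᴴ-suffix []      u = ≤ᴴ-refl u
  ≤ᴴ-suffix (d ∷ δ) u = skip (≤ᴴ-suffix δ u)

  ≤ᴴ-prefix : ∀ u δ → u ≤ᴴ (u ++ δ)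
  ≤ᴴ-prefix []      δ = []≤
  ≤ᴴ-prefix (a ∷ u) δ = keep ≤-refl (≤ᴴ-prefix u δ)

  ≤ᴴ-split : ∀ α β {v} → (α ++ β) ≤ᴴ v → ∃[ α' ] ∃[ β' ] (v ≡ α' ++ β' × α ≤ᴴ α' × β ≤ᴴ β')
  ≤ᴴ-split []      β {v} β≤v = [] , v , refl , []≤ , β≤v
  ≤ᴴ-split (a ∷ α) β (keep {b = b} a≤b r)
    with α' , β' , refl , α≤α' , β≤β' ← ≤ᴴ-split α β r
    = b ∷ α' , β' , refl , keep a≤b α≤α' , β≤β'
  ≤ᴴ-split (a ∷ α) β (skip {b = b} r)
    with α' , β' , refl , α≤α' , β≤β' ← ≤ᴴ-split (a ∷ α) β r
    = b ∷ α' , β' , refl , skip α≤α' , β≤β'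

  ·-final : ∀ X Y → IsFinal X → IsFinal Y → IsFinal (X · Y)
  ·-final X Y finX finY (α , β , xα , yβ , refl) αβ≤v =
    let α' , β' , v≡α'β' , α≤α' , β≤β' = ≤ᴴ-split α β αβ≤v
    in α' , β' , finX xα α≤α' , finY yβ β≤β' , v≡α'β'

  final-with-[]≐A* : ∀ X → IsFinal X → X [] → X ≐ A*
  final-with-[]≐A* X finX x[] = (λ _ _ → tt) , (λ v _ → finX x[] []≤)

  IsShortest : Subset → Word → Set L
  IsShortest X u = X u × (∀ v → X v → length u ≤ length v)

  shortest-resp-≐ : ∀ {X Y u} → X ≐ Y → IsShortest X u → IsShortest Y u
  shortest-resp-≐ (X⊆Y , Y⊆X) (xu , short) = X⊆Y _ xu , λ v yv → short v (Y⊆X v yv)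

  shortest-length-unique : ∀ {X u v} → IsShortest X u → IsShortest X v → length u ≡ length v
  shortest-length-unique (xu , uShort) (xv , vShort) = ≤-antisym (uShort _ xv) (vShort _ xu)

  shortest-· : ∀ {X Y α β} → IsShortest X α → IsShortest Y β → IsShortest (X · Y) (α ++ β)
  shortest-· {α = α} {β} (xα , αShort) (yβ , βShort) = (α , β , xα , yβ , refl) , short
    where
    short : ∀ v → (_ · _) v → length (α ++ β) ≤ length v
    short _ (α' , β' , xα' , yβ' , refl) =
      subst₂ _≤_ (sym (length-++ α)) (sym (length-++ α'))
        (+-mono-≤ (αShort α' xα') (βShort β' yβ'))

  cancel-⊆ˡ : ∀ X Y Z {α} → IsShortest X α → IsFinal Z
            → (∀ w → (X · Y) w → (X · Z) w) → ∀ β → Y β → Z β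
  cancel-⊆ˡ X Y Z {α} (xα , αShort) finZ XY⊆XZ β yβ
    with α' , γ , xα' , zγ , αβ≡α'γ ← XY⊆XZ (α ++ β) (α , β , xα , yβ , refl)
    with δ , _ , β≡δγ ← ++-equidivisible α β α' γ (αShort α' xα') αβ≡α'γ
    = finZ zγ (subst (γ ≤ᴴ_) (sym β≡δγ) (≤ᴴ-suffix δ γ))

  cancel-⊆ʳ : ∀ X Y Z {α} → IsShortest X α → IsFinal Z
            → (∀ w → (Y · X) w → (Z · X) w) → ∀ β → Y β → Z β
  cancel-⊆ʳ X Y Z {α} (xα , αShort) finZ YX⊆ZX β yβ
    with γ , α' , zγ , xα' , βα≡γα' ← YX⊆ZX (β ++ α) (β , α , yβ , xα , refl)
    with δ , β≡γδ ← ++-prefix-of-shorter-tail β α γ α' (αShort α' xα') βα≡γα'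
    = finZ zγ (subst (γ ≤ᴴ_) (sym β≡γδ) (≤ᴴ-prefix γ δ))

module Degree {c ℓ₁ ℓ₂ : Level} (lem : ExcludedMiddle (c ⊔ ℓ₁ ⊔ ℓ₂)) (P : Poset c ℓ₁ ℓ₂) where
  open Higman P
  open HigmanFacts P

  shortest-exists : ∀ X → NonEmpty X → ∃ (IsShortest X)
  shortest-exists X (u , xu)
    with _ , (w , xw , refl) , leastLength
           ← LeastNumber.least lem (λ n → ∃[ v ] (X v × length v ≡ n)) (length u) (u , xu , refl)
    = w , xw , λ v xv → leastLength (length v) (v , xv , refl)

  -- The length of a shortest word (0 when there is none, e.g. for ∅).
  degree : Subset → ℕ
  degree X with lem {∃ (IsShortest X)}
  ... | yes (u , _) = length u
  ... | no _        = 0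

  degree-shortest : ∀ X {u} → IsShortest X u → degree X ≡ length u
  degree-shortest X uShortest with lem {∃ (IsShortest X)}
  ... | yes (_ , wShortest) = shortest-length-unique wShortest uShortest
  ... | no none             = ⊥-elim (none (_ , uShortest))

  degree-grading : IsGrading degree
  degree-grading = respects-≐ , additive , degree-A* , degree-zero
    where
    respects-≐ : ∀ X Y → InF° X → InF° Y → X ≐ Y → degree X ≡ degree Y
    respects-≐ X Y (_ , neX) _ X≐Y =
      let _ , uShortest = shortest-exists X neX
      in trans (degree-shortest X uShortest) (sym (degree-shortest Y (shortest-resp-≐ X≐Y uShortest)))

    additive : ∀ X Y → InF° X → InF° Y → degree (X · Y) ≡ degree X + degree Y
    additive X Y (_ , neX) (_ , neY) =
      let α , αShortest = shortest-exists X neX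
          β , βShortest = shortest-exists Y neY
      in begin
        degree (X · Y)            ≡⟨ degree-shortest (X · Y) (shortest-· αShortest βShortest) ⟩
        length (α ++ β)           ≡⟨ length-++ α ⟩
        length α + length β       ≡⟨ sym (cong₂ _+_ (degree-shortest X αShortest) (degree-shortest Y βShortest)) ⟩
        degree X + degree Y       ∎
      where open ≡-Reasoning

    degree-A* : degree A* ≡ 0
    degree-A* = degree-shortest A* {[]} (tt , λ _ _ → z≤n)

    degree-zero : ∀ X → InF° X → degree X ≡ 0 → X ≐ A*
    degree-zero X (finX , neX) deg≡0 with shortest-exists X neX
    ... | [] , x[] , _ = final-with-[]≐A* X finX x[]
    ... | _ ∷ _ , shortest with () ← trans (sym (degree-shortest X shortest)) deg≡0

lemma9 : {c ℓ₁ ℓ₂ : Level} → ExcludedMiddle (c ⊔ ℓ₁ ⊔ ℓ₂) → (P : Poset c ℓ₁ ℓ₂)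
           → Higman.Submonoid P × Higman.Graded P × Higman.Cancellative P
lemma9 lem P = submonoid , (degree , degree-grading) , cancelˡ , cancelʳ
  where
  open Higman P
  open HigmanFacts P
  open Degree lem P

  submonoid : Submonoid
  submonoid = ((λ _ _ → tt) , [] , tt)
            , λ X Y (finX , u , xu) (finY , v , yv) →
                ·-final X Y finX finY , u ++ v , u , v , xu , yv , refl

  cancelˡ : ∀ X Y Z → InF° X → InF° Y → InF° Z → (X · Y) ≐ (X · Z) → Y ≐ Z
  cancelˡ X Y Z (_ , neX) (finY , _) (finZ , _) (XY⊆XZ , XZ⊆XY) =
    let _ , shortest = shortest-exists X neX
    in cancel-⊆ˡ X Y Z shortest finZ XY⊆XZ , cancel-⊆ˡ X Z Y shortest finY XZ⊆XY

  cancelʳ : ∀ X Y Z → InF° X → InF° Y → InF° Z → (Y · X) ≐ (Z · X) → Y ≐ Z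
  cancelʳ X Y Z (_ , neX) (finY , _) (finZ , _) (YX⊆ZX , ZX⊆YX) =
    let _ , shortest = shortest-exists X neX
    in cancel-⊆ʳ X Y Z shortest finZ YX⊆ZX , cancel-⊆ʳ X Z Y shortest finY ZX⊆YX
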